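{- Let $\dot G\in\mathcal C_1\cup\mathcal C_4\cup\mathcal C_5$ be a connected, non-complete, $6$-regular and $2$ net-regular strongly regular signed graph with parameters $(n,6,a,b,c)$. If $\dot G$ contains an unbalanced triangle of the second type, then either $b=1$ and $0\le a\le 3$, or $b=3$ and $a\in\{ -1,-2\}$.
   Context: Signed graphs. - A signed graph $\dot G=(G,\sigma)$ is a simple graph $G$ (the underlying graph) with a sign function $\sigma:E(G)\to\{\pm1\}$. - The adjacency matrix has entries $\sigma(v_iv_j)$ for adjacent pairs and $0$ otherwise. - Connected, complete and regular refer to $G$. - $\dot G$ is $\rho$ net-regular if every vertex has (number of positive incident edges) $-$ (number of negative incident edges) $=\rho$. - $\dot G$ is homogeneous if all edges have the same sign. Triangles. - A triangle is unbalanced if the product of its edge signs is $-1$. - An unbalanced triangle is of the second type if all three of its edges are negative. Strongly regular signed graphs. - An SRSG is a signed graph on $n$ vertices, neither homogeneous complete nor edgeless, for which there are $r\in\mathbb N$ and $a,b,c\in\mathbb Z$ such that the entries of $A(\dot G)^2$ are: - $r$ on the diagonal; - $a$ for pairs joined by a positive edge; - $b$ for pairs joined by a negative edge; - $c$ for distinct non-adjacent pairs. - $(n,r,a,b,c)$ are its parameters. Classes of inhomogeneous SRSGs. - $\mathcal C_1$: $a=-b$, and either complete, or non-complete with $c\ne0$. - $\mathcal C_4$: $a\ne-b$, non-complete, $c=0$. - $\mathcal C_5$: $a\ne-b$, non-complete, $c\ne\frac{a+b}2$ and $c\neq0$. -}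

module Defs where

open import Data.Nat using (ℕ; zero; suc)
open import Data.Integer using (ℤ; +_; -_; _+_; _*_)
open import Data.Fin using (Fin; zero; suc)
open import Data.Bool using (Bool; true; false; if_then_else_)
open import Data.Sign using (Sign)
open import Data.Product using (Σ; ∃; _×_; _,_)
open import Data.Sum using (_⊎_)
open import Relation.Binary.PropositionalEquality using (_≡_; _≢_)
open import Relation.Nullary using (¬_)

Σℤ : (n : ℕ) → (Fin n → ℤ) → ℤ
Σℤ zero    f = + 0
Σℤ (suc n) f = f zero + Σℤ n (λ k → f (suc k))

Σℕ : (n : ℕ) → (Fin n → ℕ) → ℕ
Σℕ zero    f = 0
Σℕ (suc n) f = f zero Data.Nat.+ Σℕ n (λ k → f (suc k))

-- A signed graph on vertex set Fin n: a simple graph (symmetric,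
-- irreflexive adjacency) together with a symmetric sign function
-- (only its values on edges matter).
record SignedGraph (n : ℕ) : Set where
  field
    adj      : Fin n → Fin n → Bool
    adj-sym  : ∀ i j → adj i j ≡ adj j i
    adj-irr  : ∀ i → adj i i ≡ false
    σ        : Fin n → Fin n → Sign
    σ-sym    : ∀ i j → σ i j ≡ σ j i

module _ {n : ℕ} (G : SignedGraph n) where
  open SignedGraph G

  signℤ : Sign → ℤ
  signℤ Sign.+ = + 1
  signℤ Sign.- = - (+ 1)

  A : Fin n → Fin n → ℤ
  A i j = if adj i j then signℤ (σ i j) else + 0

  A² : Fin n → Fin n → ℤ
  A² i j = Σℤ n (λ k → A i k * A k j)

  Adj : Fin n → Fin n → Set
  Adj i j = adj i j ≡ true

  PosEdge : Fin n → Fin n → Set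
  PosEdge i j = Adj i j × σ i j ≡ Sign.+

  NegEdge : Fin n → Fin n → Set
  NegEdge i j = Adj i j × σ i j ≡ Sign.-

  NonAdj : Fin n → Fin n → Set
  NonAdj i j = i ≢ j × adj i j ≡ false

  degree : Fin n → ℕ
  degree v = Σℕ n (λ k → if adj v k then 1 else 0)

  netDegree : Fin n → ℤ
  netDegree v = Σℤ n (λ k → A v k)

  Regular : ℕ → Set
  Regular r = ∀ v → degree v ≡ r

  NetRegular : ℤ → Set
  NetRegular ρ = ∀ v → netDegree v ≡ ρ

  Complete : Set
  Complete = ∀ i j → i ≢ j → Adj i j

  Edgeless : Set
  Edgeless = ∀ i j → adj i j ≡ false

  Homogeneous : Set
  Homogeneous = Σ Sign (λ s → ∀ i j → Adj i j → σ i j ≡ s)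

  data Reachable : Fin n → Fin n → Set where
    here : ∀ {i} → Reachable i i
    step : ∀ {i j k} → Adj i j → Reachable j k → Reachable i k

  Connected : Set
  Connected = ∀ i j → Reachable i j

  -- unbalanced triangle of the second type: three mutually adjacent
  -- vertices, all three edges negative
  HasNegTriangle : Set
  HasNegTriangle = Σ (Fin n) λ u → Σ (Fin n) λ v → Σ (Fin n) λ w →
    NegEdge u v × NegEdge v w × NegEdge u w

  IsSRSG : ℕ → ℤ → ℤ → ℤ → Set
  IsSRSG r a b c =
    ¬ (Homogeneous × Complete) × ¬ Edgeless ×
    (∀ i → A² i i ≡ + r) ×
    (∀ i j → PosEdge i j → A² i j ≡ a) ×
    (∀ i j → NegEdge i j → A² i j ≡ b) ×
    (∀ i j → NonAdj i j → A² i j ≡ c)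

  InC1 : ℤ → ℤ → ℤ → Set
  InC1 a b c = ¬ Homogeneous × a ≡ - b × (Complete ⊎ (¬ Complete × c ≢ + 0))

  InC4 : ℤ → ℤ → ℤ → Set
  InC4 a b c = ¬ Homogeneous × a ≢ - b × ¬ Complete × c ≡ + 0

  -- c ≠ (a+b)/2 written as 2c ≠ a + b
  InC5 : ℤ → ℤ → ℤ → Set
  InC5 a b c = ¬ Homogeneous × a ≢ - b × ¬ Complete ×
               (+ 2 * c ≢ a + b) × c ≢ + 0

-- Net-regularity gives AJ = ρJ = JA, and strong regularity reads
-- 2A² = κ∣A∣ + 2(r − c)I + (a − b)A + 2cJ with κ = a + b − 2c, which is nonzero in the
-- classes C₁, C₄, C₅ of non-complete graphs; comparing A·A² with A²·A shows that A
-- commutes with ∣A∣.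
--
-- Let uvw be a triangle with three negative edges. With degree 6 and net degree 2 every
-- vertex has two negative and four positive neighbours, so the negative neighbours of u
-- are exactly v and w. For a positive neighbour x of u let d be the number of positive
-- neighbours of u adjacent to x and m the number of v, w adjacent to x. The (u, x) entries
-- of A∣A∣ = ∣A∣A and of A² give a = d − 3m with m ≤ d ≤ 3, and the (u, v) and (u, w)
-- entries of A² give 2(b − 1) = Σₓ m. So a > 0 forces m = 0 everywhere and b = 1, and
-- a ∈ {−1, −2} forces m = 1 and b = 3. If a ≤ −3 then m = 2 and b = 5 = 6 − 1, which makes
-- the ends of every negative edge twins; then the closed negative neighbourhoods of two
-- positive neighbours of u that are not negatively adjacent would be disjoint 3-subsets
-- of the four positive neighbours of u. If a = 0 and b ≠ 1, a positive neighbour y of u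
-- adjacent to v is adjacent to all other positive neighbours of u and of v; since u and
-- v share b − 1 = 2 positive neighbours, y would have 7 neighbours.

module Submission where

open import Data.Nat as ℕ using (ℕ; zero; suc)
open import Data.Integer using (ℤ; ≢-nonZero; +_; -[1+_]; _+_; _*_; -_; _-_; _≤_; _<_; _≟_; _≤?_; _<?_; +≤+; -≤-; -≤+; +<+)
open import Data.Integer.Properties hiding (_≟_; _≤?_; _<?_)
open import Data.Integer.Tactic.RingSolver using (solve-∀)
open import Data.Fin as Fin using (Fin; zero; suc)
open import Data.Bool using (true; false; if_then_else_)
open import Data.Sign using (Sign)
open import Data.Product using (∃; _×_; _,_; proj₁; proj₂)
open import Data.Sum using (_⊎_; inj₁; inj₂)
open import Data.Empty using (⊥; ⊥-elim)
open import Relation.Nullary using (¬_; yes; no)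
open import Relation.Nullary.Decidable using (True; toWitness)
open import Relation.Binary.PropositionalEquality
open import Algebra.Properties.Semiring.Sum +-*-semiring using (sum; ∑-distrib-+; ∑-comm; *-distribˡ-sum; *-distribʳ-sum; sum-replicate-zero)
open import Algebra.Properties.Ring +-*-ring using ([y-z]x≈yx-zx)
open import Algebra.Properties.AbelianGroup +-0-abelianGroup
  using () renaming (∙-cancelˡ to +-cancelˡ-≡; ∙-cancelʳ to +-cancelʳ-≡; inverseˡ-unique to +≡0⇒≡-)
open import Defs

Σℤ≡sum : ∀ n (f : Fin n → ℤ) → Σℤ n f ≡ sum f
Σℤ≡sum zero    f = refl
Σℤ≡sum (suc n) f = cong (λ s → f zero + s) (Σℤ≡sum n (λ k → f (suc k)))

Σ-cong : ∀ {n} {f g : Fin n → ℤ} → (∀ k → f k ≡ g k) → Σℤ n f ≡ Σℤ n g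
Σ-cong {zero}  f≗g = refl
Σ-cong {suc n} f≗g = cong₂ _+_ (f≗g zero) (Σ-cong (λ k → f≗g (suc k)))

Σ-zero : ∀ n → Σℤ n (λ _ → + 0) ≡ + 0
Σ-zero n = trans (Σℤ≡sum n _) (sum-replicate-zero n)

Σ-distrib-+ : ∀ n (f g : Fin n → ℤ) → Σℤ n (λ k → f k + g k) ≡ Σℤ n f + Σℤ n g
Σ-distrib-+ n f g = begin
  Σℤ n (λ k → f k + g k) ≡⟨ Σℤ≡sum n _ ⟩
  sum (λ k → f k + g k)  ≡⟨ ∑-distrib-+ f g ⟩
  sum f + sum g          ≡⟨ cong₂ _+_ (Σℤ≡sum n f) (Σℤ≡sum n g) ⟨
  Σℤ n f + Σℤ n g        ∎
  where open ≡-Reasoning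

*-distribˡ-Σ : ∀ n x (f : Fin n → ℤ) → x * Σℤ n f ≡ Σℤ n (λ k → x * f k)
*-distribˡ-Σ n x f = begin
  x * Σℤ n f             ≡⟨ cong (x *_) (Σℤ≡sum n f) ⟩
  x * sum f              ≡⟨ *-distribˡ-sum x f ⟩
  sum (λ k → x * f k)    ≡⟨ Σℤ≡sum n _ ⟨
  Σℤ n (λ k → x * f k)   ∎
  where open ≡-Reasoning

*-distribʳ-Σ : ∀ n x (f : Fin n → ℤ) → Σℤ n f * x ≡ Σℤ n (λ k → f k * x)
*-distribʳ-Σ n x f = begin
  Σℤ n f * x             ≡⟨ cong (_* x) (Σℤ≡sum n f) ⟩
  sum f * x              ≡⟨ *-distribʳ-sum x f ⟩
  sum (λ k → f k * x)    ≡⟨ Σℤ≡sum n _ ⟨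
  Σℤ n (λ k → f k * x)   ∎
  where open ≡-Reasoning

neg-distrib-Σ : ∀ n (f : Fin n → ℤ) → - Σℤ n f ≡ Σℤ n (λ k → - f k)
neg-distrib-Σ n f = begin
  - Σℤ n f                    ≡⟨ -1*i≡-i (Σℤ n f) ⟨
  - (+ 1) * Σℤ n f            ≡⟨ *-distribˡ-Σ n (- (+ 1)) f ⟩
  Σℤ n (λ k → - (+ 1) * f k)  ≡⟨ Σ-cong (λ k → -1*i≡-i (f k)) ⟩
  Σℤ n (λ k → - f k)          ∎
  where open ≡-Reasoning

Σ-distrib-- : ∀ n (f g : Fin n → ℤ) → Σℤ n (λ k → f k - g k) ≡ Σℤ n f - Σℤ n g
Σ-distrib-- n f g = trans (Σ-distrib-+ n f (λ k → - g k)) (cong (_+_ (Σℤ n f)) (sym (neg-distrib-Σ n g)))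

Σ-comm : ∀ m n (f : Fin m → Fin n → ℤ) →
  Σℤ m (λ i → Σℤ n (f i)) ≡ Σℤ n (λ j → Σℤ m (λ i → f i j))
Σ-comm m n f = begin
  Σℤ m (λ i → Σℤ n (f i))          ≡⟨ Σ-cong (λ i → Σℤ≡sum n (f i)) ⟩
  Σℤ m (λ i → sum (f i))           ≡⟨ Σℤ≡sum m _ ⟩
  sum (λ i → sum (f i))            ≡⟨ ∑-comm f ⟩
  sum (λ j → sum (λ i → f i j))    ≡⟨ Σℤ≡sum n _ ⟨
  Σℤ n (λ j → sum (λ i → f i j))   ≡⟨ Σ-cong (λ j → Σℤ≡sum m (λ i → f i j)) ⟨
  Σℤ n (λ j → Σℤ m (λ i → f i j))  ∎
  where open ≡-Reasoning

+Σℕ≡Σℤ+ : ∀ n (f : Fin n → ℕ) → + Σℕ n f ≡ Σℤ n (λ k → + f k)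
+Σℕ≡Σℤ+ zero    f = refl
+Σℕ≡Σℤ+ (suc n) f = trans (pos-+ (f zero) _) (cong (_+_ (+ f zero)) (+Σℕ≡Σℤ+ n (λ k → f (suc k))))

Σ-mono-≤ : ∀ {n} {f g : Fin n → ℤ} → (∀ k → f k ≤ g k) → Σℤ n f ≤ Σℤ n g
Σ-mono-≤ {zero}  f≤g = ≤-refl
Σ-mono-≤ {suc n} f≤g = +-mono-≤ (f≤g zero) (Σ-mono-≤ (λ k → f≤g (suc k)))

Σ-mono-≤-≡⇒≡ : ∀ {n} {f g : Fin n → ℤ} → (∀ k → f k ≤ g k) → Σℤ n f ≡ Σℤ n g → ∀ k → f k ≡ g k
Σ-mono-≤-≡⇒≡ {suc n} {f} {g} f≤g Σf≡Σg = λ where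
    zero    → f₀≡g₀
    (suc k) → Σ-mono-≤-≡⇒≡ (λ k → f≤g (suc k)) rest≡ k
  where
  f₀≡g₀ : f zero ≡ g zero
  f₀≡g₀ = ≤∧≮⇒≡ (f≤g zero) λ f₀<g₀ →
    <-irrefl Σf≡Σg (+-mono-<-≤ f₀<g₀ (Σ-mono-≤ (λ k → f≤g (suc k))))
  rest≡ : Σℤ n (λ k → f (suc k)) ≡ Σℤ n (λ k → g (suc k))
  rest≡ = +-cancelˡ-≡ (f zero) _ _ (trans Σf≡Σg (cong (_+ Σℤ n (λ k → g (suc k))) (sym f₀≡g₀)))

Σ≡0⇒≡0 : ∀ {n} {f : Fin n → ℤ} → (∀ k → + 0 ≤ f k) → Σℤ n f ≡ + 0 → ∀ k → f k ≡ + 0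
Σ≡0⇒≡0 {n} f≥0 Σf≡0 k = sym (Σ-mono-≤-≡⇒≡ f≥0 (trans (Σ-zero n) (sym Σf≡0)) k)

Σ-<⇒∃< : ∀ {n} {f g : Fin n → ℤ} → Σℤ n f < Σℤ n g → ∃ λ k → f k < g k
Σ-<⇒∃< {zero} (+<+ ())
Σ-<⇒∃< {suc n} {f} {g} Σf<Σg with f zero <? g zero | Σℤ n (λ k → f (suc k)) <? Σℤ n (λ k → g (suc k))
... | yes f₀<g₀ | _ = zero , f₀<g₀
... | no _ | yes rest< with Σ-<⇒∃< rest<
...   | k , fk<gk = suc k , fk<gk
Σ-<⇒∃< {suc n} {f} {g} Σf<Σg | no f₀≮g₀ | no rest≮ =
  ⊥-elim (<⇒≱ Σf<Σg (+-mono-≤ (≮⇒≥ f₀≮g₀) (≮⇒≥ rest≮)))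

Σ-linear : ∀ n (x y z w : ℤ) (f g h l : Fin n → ℤ) →
  Σℤ n (λ k → x * f k + y * g k + z * h k + w * l k) ≡ x * Σℤ n f + y * Σℤ n g + z * Σℤ n h + w * Σℤ n l
Σ-linear n x y z w f g h l = begin
  Σℤ n (λ k → x * f k + y * g k + z * h k + w * l k)
    ≡⟨ trans (Σ-distrib-+ n _ _) (cong₂ _+_ (trans (Σ-distrib-+ n _ _) (cong₂ _+_ (Σ-distrib-+ n _ _) refl)) refl) ⟩
  Σℤ n (λ k → x * f k) + Σℤ n (λ k → y * g k) + Σℤ n (λ k → z * h k) + Σℤ n (λ k → w * l k)
    ≡⟨ cong₂ _+_ (cong₂ _+_ (cong₂ _+_ (*-distribˡ-Σ n x f) (*-distribˡ-Σ n y g)) (*-distribˡ-Σ n z h)) (*-distribˡ-Σ n w l) ⟨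
  x * Σℤ n f + y * Σℤ n g + z * Σℤ n h + w * Σℤ n l ∎
  where open ≡-Reasoning

δ : ∀ {n} → Fin n → Fin n → ℤ
δ i k with i Fin.≟ k
... | yes _ = + 1
... | no _  = + 0

δ-refl : ∀ {n} (i : Fin n) → δ i i ≡ + 1
δ-refl i with i Fin.≟ i
... | yes _   = refl
... | no i≢i = ⊥-elim (i≢i refl)

δ-≢ : ∀ {n} {i k : Fin n} → i ≢ k → δ i k ≡ + 0
δ-≢ {i = i} {k} i≢k with i Fin.≟ k
... | yes i≡k = ⊥-elim (i≢k i≡k)
... | no _    = refl

δ-sym : ∀ {n} (i k : Fin n) → δ i k ≡ δ k i
δ-sym i k with i Fin.≟ k
... | yes refl = sym (δ-refl i)
... | no i≢k   = sym (δ-≢ (λ k≡i → i≢k (sym k≡i)))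

δ-suc : ∀ {n} (i k : Fin n) → δ (suc i) (suc k) ≡ δ i k
δ-suc i k with i Fin.≟ k
... | yes _ = refl
... | no _  = refl

Σ-δ : ∀ {n} (i : Fin n) (f : Fin n → ℤ) → Σℤ n (λ k → δ i k * f k) ≡ f i
Σ-δ {suc n} zero f = begin
  + 1 * f zero + Σℤ n (λ k → + 0 * f (suc k)) ≡⟨ cong (_+_ (+ 1 * f zero)) (Σ-cong (λ k → *-zeroˡ (f (suc k)))) ⟩
  + 1 * f zero + Σℤ n (λ _ → + 0)             ≡⟨ cong (_+_ (+ 1 * f zero)) (Σ-zero n) ⟩
  + 1 * f zero + + 0                          ≡⟨ +-identityʳ _ ⟩
  + 1 * f zero                                ≡⟨ *-identityˡ _ ⟩
  f zero                                      ∎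
  where open ≡-Reasoning
Σ-δ {suc n} (suc i) f = begin
  + 0 * f zero + Σℤ n (λ k → δ (suc i) (suc k) * f (suc k))
    ≡⟨ cong₂ _+_ (*-zeroˡ (f zero)) (Σ-cong (λ k → cong (_* f (suc k)) (δ-suc i k))) ⟩
  + 0 + Σℤ n (λ k → δ i k * f (suc k))
    ≡⟨ +-identityˡ _ ⟩
  Σℤ n (λ k → δ i k * f (suc k))
    ≡⟨ Σ-δ i (λ k → f (suc k)) ⟩
  f (suc i) ∎
  where open ≡-Reasoning

Σ-δ₁ : ∀ {n} (i : Fin n) → Σℤ n (δ i) ≡ + 1
Σ-δ₁ i = trans (Σ-cong (λ k → sym (*-identityʳ (δ i k)))) (Σ-δ i (λ _ → + 1))

Σ-δ+δ : ∀ {n} (v w : Fin n) (f : Fin n → ℤ) → Σℤ n (λ k → (δ v k + δ w k) * f k) ≡ f v + f w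
Σ-δ+δ {n} v w f = begin
  Σℤ n (λ k → (δ v k + δ w k) * f k)           ≡⟨ Σ-cong (λ k → *-distribʳ-+ (f k) (δ v k) (δ w k)) ⟩
  Σℤ n (λ k → δ v k * f k + δ w k * f k)       ≡⟨ Σ-distrib-+ n _ _ ⟩
  Σℤ n (λ k → δ v k * f k) + Σℤ n (λ k → δ w k * f k) ≡⟨ cong₂ _+_ (Σ-δ v f) (Σ-δ w f) ⟩
  f v + f w                                    ∎
  where open ≡-Reasoning

≡δ+δ : ∀ {n} {f : Fin n → ℤ} {v w} → v ≢ w → (∀ k → + 0 ≤ f k) → f v ≡ + 1 → f w ≡ + 1 →
       Σℤ n f ≡ + 2 → ∀ k → f k ≡ δ v k + δ w k
≡δ+δ {n} {f} {v} {w} v≢w f≥0 fv≡1 fw≡1 Σf≡2 k = sym (Σ-mono-≤-≡⇒≡ bound (trans Σδ+δ≡2 (sym Σf≡2)) k)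
  where
  bound : ∀ k → δ v k + δ w k ≤ f k
  bound k with v Fin.≟ k | w Fin.≟ k
  ... | yes refl | yes refl = ⊥-elim (v≢w refl)
  ... | yes refl | no _     = ≤-reflexive (sym fv≡1)
  ... | no _     | yes refl = ≤-reflexive (sym fw≡1)
  ... | no _     | no _     = f≥0 k
  Σδ+δ≡2 : Σℤ n (λ k → δ v k + δ w k) ≡ + 2
  Σδ+δ≡2 = trans (Σ-distrib-+ n (δ v) (δ w)) (cong₂ _+_ (Σ-δ₁ v) (Σ-δ₁ w))

≤-decide : ∀ {x y} {_ : True (x ≤? y)} → x ≤ y
≤-decide {_} {_} {x≤y} = toWitness x≤y

<-decide : ∀ {x y} {_ : True (x <? y)} → x < y
<-decide {_} {_} {x<y} = toWitness x<y

≰-decide : ∀ {x y} {_ : True (y <? x)} → ¬ x ≤ y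
≰-decide {_} {_} {y<x} = <⇒≱ (toWitness y<x)

0≤i∧i≢0⇒1≤i : ∀ {i} → + 0 ≤ i → i ≢ + 0 → + 1 ≤ i
0≤i∧i≢0⇒1≤i 0≤i i≢0 = i<j⇒suc[i]≤j (≤∧≢⇒< 0≤i (λ 0≡i → i≢0 (sym 0≡i)))

i≤0∧i≢0⇒i≤-1 : ∀ {i} → i ≤ + 0 → i ≢ + 0 → i ≤ - + 1
i≤0∧i≢0⇒i≤-1 {+ zero}   _        i≢0 = ⊥-elim (i≢0 refl)
i≤0∧i≢0⇒i≤-1 {+ suc _}  (+≤+ ()) _
i≤0∧i≢0⇒i≤-1 { -[1+ _ ]} _       _   = -≤- ℕ.z≤n

-2≤i≤-1⇒i≡-1∨i≡-2 : ∀ {i} → - + 2 ≤ i → i ≤ - + 1 → i ≡ - + 1 ⊎ i ≡ - + 2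
-2≤i≤-1⇒i≡-1∨i≡-2 { -[1+ 0 ]}       _                      _ = inj₁ refl
-2≤i≤-1⇒i≡-1∨i≡-2 { -[1+ 1 ]}       _                      _ = inj₂ refl
-2≤i≤-1⇒i≡-1∨i≡-2 { -[1+ suc (suc _) ]} (-≤- (ℕ.s≤s ())) _
-2≤i≤-1⇒i≡-1∨i≡-2 {+ _}             _                     ()

1≢0 : + 1 ≢ + 0
1≢0 ()

Bit : ℤ → Set
Bit x = x ≡ + 0 ⊎ x ≡ + 1

Bit⇒0≤ : ∀ {x} → Bit x → + 0 ≤ x
Bit⇒0≤ (inj₁ refl) = +≤+ ℕ.z≤n
Bit⇒0≤ (inj₂ refl) = +≤+ ℕ.z≤n

Bit⇒≤1 : ∀ {x} → Bit x → x ≤ + 1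
Bit⇒≤1 (inj₁ refl) = +≤+ ℕ.z≤n
Bit⇒≤1 (inj₂ refl) = ≤-refl

δ-bit : ∀ {n} (i k : Fin n) → Bit (δ i k)
δ-bit i k with i Fin.≟ k
... | yes _ = inj₂ refl
... | no _  = inj₁ refl

Bit-0<⇒≡1 : ∀ {p} → Bit p → + 0 < p → p ≡ + 1
Bit-0<⇒≡1 (inj₁ refl) (+<+ ())
Bit-0<⇒≡1 (inj₂ refl) _ = refl

Bit*Bit-0<⇒≡1 : ∀ {p q} → Bit p → Bit q → + 0 < p * q → p ≡ + 1 × q ≡ + 1
Bit*Bit-0<⇒≡1 (inj₁ refl) _           (+<+ ())
Bit*Bit-0<⇒≡1 (inj₂ refl) (inj₁ refl) (+<+ ())
Bit*Bit-0<⇒≡1 (inj₂ refl) (inj₂ refl) _ = refl , refl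

1+Bit≢0 : ∀ {p q} → p ≡ + 1 → Bit q → p + q ≢ + 0
1+Bit≢0 refl (inj₁ refl) ()
1+Bit≢0 refl (inj₂ refl) ()

Bit+Bit<Bit : ∀ {p q r} → Bit p → Bit q → Bit r → p + q < r → p ≡ + 0 × q ≡ + 0 × r ≡ + 1
Bit+Bit<Bit (inj₁ refl) (inj₁ refl) (inj₂ refl) _ = refl , refl , refl
Bit+Bit<Bit (inj₁ refl) (inj₁ refl) (inj₁ refl) p+q<r = ⊥-elim (<⇒≱ p+q<r ≤-refl)
Bit+Bit<Bit (inj₁ refl) (inj₂ refl) (inj₁ refl) p+q<r = ⊥-elim (<⇒≱ p+q<r ≤-decide)
Bit+Bit<Bit (inj₁ refl) (inj₂ refl) (inj₂ refl) p+q<r = ⊥-elim (<⇒≱ p+q<r ≤-refl)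
Bit+Bit<Bit (inj₂ refl) (inj₁ refl) (inj₁ refl) p+q<r = ⊥-elim (<⇒≱ p+q<r ≤-decide)
Bit+Bit<Bit (inj₂ refl) (inj₁ refl) (inj₂ refl) p+q<r = ⊥-elim (<⇒≱ p+q<r ≤-refl)
Bit+Bit<Bit (inj₂ refl) (inj₂ refl) (inj₁ refl) p+q<r = ⊥-elim (<⇒≱ p+q<r ≤-decide)
Bit+Bit<Bit (inj₂ refl) (inj₂ refl) (inj₂ refl) p+q<r = ⊥-elim (<⇒≱ p+q<r ≤-decide)

Bit-disjoint-≤ : ∀ {p q r} → Bit p → Bit q → Bit r →
  (p ≡ + 1 → q ≡ + 1 → ⊥) → (p ≡ + 1 → r ≡ + 1) → (q ≡ + 1 → r ≡ + 1) → p + q ≤ r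
Bit-disjoint-≤ (inj₁ refl) (inj₁ refl) r          _ _ _ = Bit⇒0≤ r
Bit-disjoint-≤ (inj₂ refl) (inj₂ refl) _          p∧q _ _ = ⊥-elim (p∧q refl refl)
Bit-disjoint-≤ (inj₂ refl) (inj₁ refl) _          _ p⇒r _ rewrite p⇒r refl = ≤-refl
Bit-disjoint-≤ (inj₁ refl) (inj₂ refl) _          _ _ q⇒r rewrite q⇒r refl = ≤-refl

Bit-union-≤ : ∀ {p q r} → Bit p → Bit q → Bit r →
  (p ≡ + 1 → r ≡ + 1) → (q ≡ + 1 → r ≡ + 1) → p + q ≤ r + p * q
Bit-union-≤ (inj₁ refl) (inj₁ refl) (inj₁ refl) _ _ = ≤-refl
Bit-union-≤ (inj₁ refl) (inj₁ refl) (inj₂ refl) _ _ = ≤-decide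
Bit-union-≤ (inj₂ refl) (inj₁ refl) _          p⇒r _ rewrite p⇒r refl = ≤-refl
Bit-union-≤ (inj₂ refl) (inj₂ refl) _          p⇒r _ rewrite p⇒r refl = ≤-refl
Bit-union-≤ (inj₁ refl) (inj₂ refl) _          _ q⇒r rewrite q⇒r refl = ≤-refl

Bit-*-cong : ∀ {p x y} → Bit p → (p ≡ + 1 → x ≡ y) → p * x ≡ p * y
Bit-*-cong (inj₁ refl) _    = refl
Bit-*-cong (inj₂ refl) x≡y = cong (_*_ (+ 1)) (x≡y refl)

Bit-*-nonneg : ∀ {p x} → Bit p → + 0 ≤ x → + 0 ≤ p * x
Bit-*-nonneg (inj₁ refl) _   = ≤-refl
Bit-*-nonneg (inj₂ refl) 0≤x = subst (+ 0 ≤_) (sym (*-identityˡ _)) 0≤x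

Bit-*-≤ : ∀ {p x} → Bit p → x ≤ + 1 → p * x ≤ p
Bit-*-≤ (inj₁ refl) _   = ≤-refl
Bit-*-≤ (inj₂ refl) x≤1 = subst (_≤ + 1) (sym (*-identityˡ _)) x≤1

-- The matrices A, ∣A∣, A⁺ and A⁻ of a signed graph

module _ {n : ℕ} (G : SignedGraph n) where
  open SignedGraph G

  private
    isPos isNeg : Sign → ℤ
    isPos Sign.+ = + 1
    isPos Sign.- = + 0
    isNeg Sign.+ = + 0
    isNeg Sign.- = + 1

  ∣A∣ A⁺ A⁻ : Fin n → Fin n → ℤ
  ∣A∣ i j = if adj i j then + 1 else + 0
  A⁺ i j = if adj i j then isPos (σ i j) else + 0
  A⁻ i j = if adj i j then isNeg (σ i j) else + 0

  ∣A∣≡A⁺+A⁻ : ∀ i j → ∣A∣ i j ≡ A⁺ i j + A⁻ i j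
  ∣A∣≡A⁺+A⁻ i j with adj i j | σ i j
  ... | true  | Sign.+ = refl
  ... | true  | Sign.- = refl
  ... | false | _      = refl

  A≡A⁺-A⁻ : ∀ i j → A G i j ≡ A⁺ i j - A⁻ i j
  A≡A⁺-A⁻ i j with adj i j | σ i j
  ... | true  | Sign.+ = refl
  ... | true  | Sign.- = refl
  ... | false | _      = refl

  ∣A∣-bit : ∀ i j → Bit (∣A∣ i j)
  ∣A∣-bit i j with adj i j
  ... | true  = inj₂ refl
  ... | false = inj₁ refl

  A⁺-bit : ∀ i j → Bit (A⁺ i j)
  A⁺-bit i j with adj i j | σ i j
  ... | true  | Sign.+ = inj₂ refl
  ... | true  | Sign.- = inj₁ refl
  ... | false | _      = inj₁ refl

  A⁻-bit : ∀ i j → Bit (A⁻ i j)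
  A⁻-bit i j with adj i j | σ i j
  ... | true  | Sign.+ = inj₁ refl
  ... | true  | Sign.- = inj₂ refl
  ... | false | _      = inj₁ refl

  A-sym : ∀ i j → A G i j ≡ A G j i
  A-sym i j rewrite adj-sym i j | σ-sym i j = refl

  ∣A∣-sym : ∀ i j → ∣A∣ i j ≡ ∣A∣ j i
  ∣A∣-sym i j rewrite adj-sym i j = refl

  A⁺-sym : ∀ i j → A⁺ i j ≡ A⁺ j i
  A⁺-sym i j rewrite adj-sym i j | σ-sym i j = refl

  A⁻-sym : ∀ i j → A⁻ i j ≡ A⁻ j i
  A⁻-sym i j rewrite adj-sym i j | σ-sym i j = refl

  A-irrefl : ∀ i → A G i i ≡ + 0
  A-irrefl i rewrite adj-irr i = refl

  ∣A∣-irrefl : ∀ i → ∣A∣ i i ≡ + 0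
  ∣A∣-irrefl i rewrite adj-irr i = refl

  A⁺-irrefl : ∀ i → A⁺ i i ≡ + 0
  A⁺-irrefl i rewrite adj-irr i = refl

  A⁻-irrefl : ∀ i → A⁻ i i ≡ + 0
  A⁻-irrefl i rewrite adj-irr i = refl

  A⁺≡1⇒PosEdge : ∀ {i j} → A⁺ i j ≡ + 1 → PosEdge G i j
  A⁺≡1⇒PosEdge {i} {j} A⁺ij≡1 with adj i j | σ i j | A⁺ij≡1
  ... | true  | Sign.+ | _ = refl , refl
  ... | true  | Sign.- | ()
  ... | false | _      | ()

  A⁻≡1⇒NegEdge : ∀ {i j} → A⁻ i j ≡ + 1 → NegEdge G i j
  A⁻≡1⇒NegEdge {i} {j} A⁻ij≡1 with adj i j | σ i j | A⁻ij≡1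
  ... | true  | Sign.- | _ = refl , refl
  ... | true  | Sign.+ | ()
  ... | false | _      | ()

  NegEdge⇒A⁻≡1 : ∀ {i j} → NegEdge G i j → A⁻ i j ≡ + 1
  NegEdge⇒A⁻≡1 (adj≡true , σ≡-) rewrite adj≡true | σ≡- = refl

  NegEdge⇒A≡-1 : ∀ {i j} → NegEdge G i j → A G i j ≡ - + 1
  NegEdge⇒A≡-1 (adj≡true , σ≡-) rewrite adj≡true | σ≡- = refl

  NegEdge⇒∣A∣≡1 : ∀ {i j} → NegEdge G i j → ∣A∣ i j ≡ + 1
  NegEdge⇒∣A∣≡1 (adj≡true , _) rewrite adj≡true = refl

  NegEdge-sym : ∀ {i j} → NegEdge G i j → NegEdge G j i
  NegEdge-sym {i} {j} (adj≡true , σ≡-) = trans (adj-sym j i) adj≡true , trans (σ-sym j i) σ≡-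

  NegEdge⇒≢ : ∀ {i j} → NegEdge G i j → i ≢ j
  NegEdge⇒≢ {i} (adj≡true , _) refl with trans (sym adj≡true) (adj-irr i)
  ... | ()

  A≡1⇒A⁺≡1 : ∀ {i j} → A G i j ≡ + 1 → A⁺ i j ≡ + 1
  A≡1⇒A⁺≡1 {i} {j} Aij≡1 with adj i j | σ i j | Aij≡1
  ... | true  | Sign.+ | _ = refl
  ... | true  | Sign.- | ()
  ... | false | _      | ()

  A≡-1⇒A⁻≡1 : ∀ {i j} → A G i j ≡ - + 1 → A⁻ i j ≡ + 1
  A≡-1⇒A⁻≡1 {i} {j} Aij≡-1 with adj i j | σ i j | Aij≡-1
  ... | true  | Sign.- | _ = refl
  ... | true  | Sign.+ | ()
  ... | false | _      | ()

  A⁺≡1⇒A≡1 : ∀ {i j} → A⁺ i j ≡ + 1 → A G i j ≡ + 1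
  A⁺≡1⇒A≡1 {i} {j} A⁺ij≡1 with adj i j | σ i j | A⁺ij≡1
  ... | true  | Sign.+ | _ = refl
  ... | true  | Sign.- | ()
  ... | false | _      | ()

  A⁺≡1⇒∣A∣≡1 : ∀ {i j} → A⁺ i j ≡ + 1 → ∣A∣ i j ≡ + 1
  A⁺≡1⇒∣A∣≡1 {i} {j} A⁺ij≡1 with adj i j | σ i j | A⁺ij≡1
  ... | true  | Sign.+ | _ = refl
  ... | true  | Sign.- | ()
  ... | false | _      | ()

  A⁺≡1⇒A⁻≡0 : ∀ {i j} → A⁺ i j ≡ + 1 → A⁻ i j ≡ + 0
  A⁺≡1⇒A⁻≡0 {i} {j} A⁺ij≡1 with adj i j | σ i j | A⁺ij≡1
  ... | true  | Sign.+ | _ = refl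
  ... | true  | Sign.- | ()
  ... | false | _      | ()

  A⁻≡0⇒A≡∣A∣ : ∀ {i j} → A⁻ i j ≡ + 0 → A G i j ≡ ∣A∣ i j
  A⁻≡0⇒A≡∣A∣ {i} {j} A⁻ij≡0 with adj i j | σ i j | A⁻ij≡0
  ... | true  | Sign.+ | _ = refl
  ... | true  | Sign.- | ()
  ... | false | _      | _ = refl

  A⁻≡0⇒A⁺≡∣A∣ : ∀ {i j} → A⁻ i j ≡ + 0 → A⁺ i j ≡ ∣A∣ i j
  A⁻≡0⇒A⁺≡∣A∣ {i} {j} A⁻ij≡0 with adj i j | σ i j | A⁻ij≡0
  ... | true  | Sign.+ | _ = refl
  ... | true  | Sign.- | ()
  ... | false | _      | _ = refl

  NegEdge⇒A⁺≡0 : ∀ {i j} → NegEdge G i j → A⁺ i j ≡ + 0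
  NegEdge⇒A⁺≡0 (adj≡true , σ≡-) rewrite adj≡true | σ≡- = refl

  -∣A∣≤A : ∀ i j → - ∣A∣ i j ≤ A G i j
  -∣A∣≤A i j with adj i j | σ i j
  ... | true  | Sign.+ = -≤+
  ... | true  | Sign.- = ≤-refl
  ... | false | _      = ≤-refl

  A*A≤∣A∣ : ∀ i k j → A G i k * A G k j ≤ ∣A∣ k j
  A*A≤∣A∣ i k j with adj i k | σ i k | adj k j | σ k j
  ... | false | _      | true  | _      = +≤+ ℕ.z≤n
  ... | false | _      | false | _      = ≤-refl
  ... | true  | Sign.+ | false | _      = ≤-refl
  ... | true  | Sign.- | false | _      = ≤-refl
  ... | true  | Sign.+ | true  | Sign.+ = ≤-refl
  ... | true  | Sign.+ | true  | Sign.- = -≤+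
  ... | true  | Sign.- | true  | Sign.+ = -≤+
  ... | true  | Sign.- | true  | Sign.- = ≤-refl

  A*A≡1⇒A≡A : ∀ i k j → A G i k * A G k j ≡ + 1 → A G i k ≡ A G k j
  A*A≡1⇒A≡A i k j A*A≡1 with adj i k | σ i k | adj k j | σ k j | A*A≡1
  ... | true  | Sign.+ | true  | Sign.+ | _ = refl
  ... | true  | Sign.- | true  | Sign.- | _ = refl
  ... | true  | Sign.+ | true  | Sign.- | ()
  ... | true  | Sign.- | true  | Sign.+ | ()
  ... | true  | Sign.+ | false | _      | ()
  ... | true  | Sign.- | false | _      | ()
  ... | false | _      | _     | _      | ()

  Σ∣A∣≡degree : ∀ v → Σℤ n (∣A∣ v) ≡ + degree G v
  Σ∣A∣≡degree v = sym (trans (+Σℕ≡Σℤ+ n _) (Σ-cong entry))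
    where
    entry : ∀ k → + (if adj v k then 1 else 0) ≡ ∣A∣ v k
    entry k with adj v k
    ... | true  = refl
    ... | false = refl

  2*ΣA⁻≡degree-netDegree : ∀ v → + 2 * Σℤ n (A⁻ v) ≡ + degree G v - netDegree G v
  2*ΣA⁻≡degree-netDegree v = begin
    + 2 * Σℤ n (A⁻ v)                  ≡⟨ *-distribˡ-Σ n (+ 2) (A⁻ v) ⟩
    Σℤ n (λ k → + 2 * A⁻ v k)          ≡⟨ Σ-cong entry ⟩
    Σℤ n (λ k → ∣A∣ v k - A G v k)     ≡⟨ Σ-distrib-- n (∣A∣ v) (A G v) ⟩
    Σℤ n (∣A∣ v) - netDegree G v       ≡⟨ cong (_- netDegree G v) (Σ∣A∣≡degree v) ⟩
    + degree G v - netDegree G v       ∎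
    where
    open ≡-Reasoning
    entry : ∀ k → + 2 * A⁻ v k ≡ ∣A∣ v k - A G v k
    entry k = trans (identity (A⁺ v k) (A⁻ v k)) (sym (cong₂ _-_ (∣A∣≡A⁺+A⁻ v k) (A≡A⁺-A⁻ v k)))
      where identity : ∀ p q → + 2 * q ≡ (p + q) - (p - q)
            identity = solve-∀

  2*ΣA⁺≡degree+netDegree : ∀ v → + 2 * Σℤ n (A⁺ v) ≡ + degree G v + netDegree G v
  2*ΣA⁺≡degree+netDegree v = begin
    + 2 * Σℤ n (A⁺ v)                  ≡⟨ *-distribˡ-Σ n (+ 2) (A⁺ v) ⟩
    Σℤ n (λ k → + 2 * A⁺ v k)          ≡⟨ Σ-cong entry ⟩
    Σℤ n (λ k → ∣A∣ v k + A G v k)     ≡⟨ Σ-distrib-+ n (∣A∣ v) (A G v) ⟩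
    Σℤ n (∣A∣ v) + netDegree G v       ≡⟨ cong (_+ netDegree G v) (Σ∣A∣≡degree v) ⟩
    + degree G v + netDegree G v       ∎
    where
    open ≡-Reasoning
    entry : ∀ k → + 2 * A⁺ v k ≡ ∣A∣ v k + A G v k
    entry k = trans (identity (A⁺ v k) (A⁻ v k)) (sym (cong₂ _+_ (∣A∣≡A⁺+A⁻ v k) (A≡A⁺-A⁻ v k)))
      where identity : ∀ p q → + 2 * p ≡ (p + q) + (p - q)
            identity = solve-∀

infixl 7 _⊙_
_⊙_ : ∀ {n} → (Fin n → Fin n → ℤ) → (Fin n → Fin n → ℤ) → Fin n → Fin n → ℤ
(M ⊙ N) i j = Σℤ _ (λ k → M i k * N k j)

⊙-assoc : ∀ {n} (L M N : Fin n → Fin n → ℤ) i j → ((L ⊙ M) ⊙ N) i j ≡ (L ⊙ (M ⊙ N)) i j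
⊙-assoc {n} L M N i j = begin
  Σℤ n (λ l → Σℤ n (λ k → L i k * M k l) * N l j)   ≡⟨ Σ-cong (λ l → *-distribʳ-Σ n (N l j) _) ⟩
  Σℤ n (λ l → Σℤ n (λ k → L i k * M k l * N l j))   ≡⟨ Σ-comm n n _ ⟩
  Σℤ n (λ k → Σℤ n (λ l → L i k * M k l * N l j))   ≡⟨ Σ-cong (λ k → Σ-cong (λ l → *-assoc (L i k) (M k l) (N l j))) ⟩
  Σℤ n (λ k → Σℤ n (λ l → L i k * (M k l * N l j))) ≡⟨ Σ-cong (λ k → *-distribˡ-Σ n (L i k) _) ⟨
  Σℤ n (λ k → L i k * Σℤ n (λ l → M k l * N l j))   ∎
  where open ≡-Reasoning

-- A commutes with ∣A∣

module _ {n} (G : SignedGraph n) {r : ℕ} {a b c ρ : ℤ}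
  (srsg : IsSRSG G r a b c) (net : NetRegular G ρ) (a+b≢2c : a + b ≢ + 2 * c) where

  private
    κ s t : ℤ
    κ = a + b - + 2 * c
    s = + 2 * (+ r - c)
    t = a - b

    A²-diag : ∀ i → A² G i i ≡ + r
    A²-diag = proj₁ (proj₂ (proj₂ srsg))
    A²-pos : ∀ i j → PosEdge G i j → A² G i j ≡ a
    A²-pos = proj₁ (proj₂ (proj₂ (proj₂ srsg)))
    A²-neg : ∀ i j → NegEdge G i j → A² G i j ≡ b
    A²-neg = proj₁ (proj₂ (proj₂ (proj₂ (proj₂ srsg))))
    A²-non : ∀ i j → NonAdj G i j → A² G i j ≡ c
    A²-non = proj₂ (proj₂ (proj₂ (proj₂ (proj₂ srsg))))

  2*A²≡κ∣A∣+sδ+tA+2c : ∀ k j → + 2 * A² G k j ≡ κ * ∣A∣ G k j + s * δ k j + t * A G k j + + 2 * c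
  2*A²≡κ∣A∣+sδ+tA+2c k j with k Fin.≟ j
  ... | yes refl rewrite A²-diag k | ∣A∣-irrefl G k | A-irrefl G k = diagonal a b c (+ r)
    where
    diagonal : ∀ a b c x → + 2 * x ≡ (a + b - + 2 * c) * + 0 + + 2 * (x - c) * + 1 + (a - b) * + 0 + + 2 * c
    diagonal = solve-∀
  ... | no k≢j with SignedGraph.adj G k j in adj≡ | SignedGraph.σ G k j in σ≡
  ...   | true  | Sign.+ rewrite A²-pos k j (adj≡ , σ≡) = positive a b c (+ r)
    where
    positive : ∀ a b c x → + 2 * a ≡ (a + b - + 2 * c) * + 1 + + 2 * (x - c) * + 0 + (a - b) * + 1 + + 2 * c
    positive = solve-∀
  ...   | true  | Sign.- rewrite A²-neg k j (adj≡ , σ≡) = negative a b c (+ r)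
    where
    negative : ∀ a b c x → + 2 * b ≡ (a + b - + 2 * c) * + 1 + + 2 * (x - c) * + 0 + (a - b) * - + 1 + + 2 * c
    negative = solve-∀
  ...   | false | _      rewrite A²-non k j (k≢j , adj≡) = nonadjacent a b c (+ r)
    where
    nonadjacent : ∀ a b c x → + 2 * c ≡ (a + b - + 2 * c) * + 0 + + 2 * (x - c) * + 0 + (a - b) * + 0 + + 2 * c
    nonadjacent = solve-∀

  private
    R : Fin n → Fin n → ℤ
    R i j = s * A G i j + t * A² G i j + + 2 * c * ρ

    expandˡ : ∀ x e d y κ s t u → x * (κ * e + s * d + t * y + u) ≡ κ * (x * e) + s * (d * x) + t * (x * y) + u * x
    expandˡ = solve-∀

    move-2 : ∀ x y → + 2 * (x * y) ≡ x * (+ 2 * y)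
    move-2 = solve-∀

    expandʳ : ∀ x e d y κ s t u → (κ * e + s * d + t * y + u) * x ≡ κ * (e * x) + s * (d * x) + t * (y * x) + u * x
    expandʳ = solve-∀

  2*A⊙A²≡κA⊙∣A∣+R : ∀ i j → + 2 * (A G ⊙ A² G) i j ≡ κ * (A G ⊙ ∣A∣ G) i j + R i j
  2*A⊙A²≡κA⊙∣A∣+R i j = begin
    + 2 * Σℤ n (λ k → A G i k * A² G k j)
      ≡⟨ *-distribˡ-Σ n (+ 2) _ ⟩
    Σℤ n (λ k → + 2 * (A G i k * A² G k j))
      ≡⟨ Σ-cong term ⟩
    Σℤ n (λ k → κ * (A G i k * ∣A∣ G k j) + s * (δ j k * A G i k) + t * (A G i k * A G k j) + + 2 * c * A G i k)
      ≡⟨ Σ-linear n κ s t (+ 2 * c) _ _ _ _ ⟩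
    κ * (A G ⊙ ∣A∣ G) i j + s * Σℤ n (λ k → δ j k * A G i k) + t * A² G i j + + 2 * c * Σℤ n (A G i)
      ≡⟨ cong₂ (λ x y → κ * (A G ⊙ ∣A∣ G) i j + s * x + t * A² G i j + + 2 * c * y) (Σ-δ j (A G i)) (net i) ⟩
    κ * (A G ⊙ ∣A∣ G) i j + s * A G i j + t * A² G i j + + 2 * c * ρ
      ≡⟨ reassociate (κ * (A G ⊙ ∣A∣ G) i j) (s * A G i j) (t * A² G i j) (+ 2 * c * ρ) ⟩
    κ * (A G ⊙ ∣A∣ G) i j + R i j ∎
    where
    open ≡-Reasoning
    reassociate : ∀ x y z w → x + y + z + w ≡ x + (y + z + w)
    reassociate = solve-∀
    term : ∀ k → + 2 * (A G i k * A² G k j) ≡ κ * (A G i k * ∣A∣ G k j) + s * (δ j k * A G i k) + t * (A G i k * A G k j) + + 2 * c * A G i k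
    term k = begin
      + 2 * (A G i k * A² G k j)                                      ≡⟨ move-2 (A G i k) (A² G k j) ⟩
      A G i k * (+ 2 * A² G k j)                                      ≡⟨ cong (A G i k *_) (2*A²≡κ∣A∣+sδ+tA+2c k j) ⟩
      A G i k * (κ * ∣A∣ G k j + s * δ k j + t * A G k j + + 2 * c)
        ≡⟨ cong (λ d → A G i k * (κ * ∣A∣ G k j + s * d + t * A G k j + + 2 * c)) (δ-sym k j) ⟩
      A G i k * (κ * ∣A∣ G k j + s * δ j k + t * A G k j + + 2 * c)
        ≡⟨ expandˡ (A G i k) (∣A∣ G k j) (δ j k) (A G k j) κ s t (+ 2 * c) ⟩
      κ * (A G i k * ∣A∣ G k j) + s * (δ j k * A G i k) + t * (A G i k * A G k j) + + 2 * c * A G i k ∎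

  2*A²⊙A≡κ∣A∣⊙A+R : ∀ i j → + 2 * (A² G ⊙ A G) i j ≡ κ * (∣A∣ G ⊙ A G) i j + R i j
  2*A²⊙A≡κ∣A∣⊙A+R i j = begin
    + 2 * Σℤ n (λ k → A² G i k * A G k j)
      ≡⟨ *-distribˡ-Σ n (+ 2) _ ⟩
    Σℤ n (λ k → + 2 * (A² G i k * A G k j))
      ≡⟨ Σ-cong term ⟩
    Σℤ n (λ k → κ * (∣A∣ G i k * A G k j) + s * (δ i k * A G k j) + t * (A G i k * A G k j) + + 2 * c * A G k j)
      ≡⟨ Σ-linear n κ s t (+ 2 * c) _ _ _ _ ⟩
    κ * (∣A∣ G ⊙ A G) i j + s * Σℤ n (λ k → δ i k * A G k j) + t * A² G i j + + 2 * c * Σℤ n (λ k → A G k j)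
      ≡⟨ cong₂ (λ x y → κ * (∣A∣ G ⊙ A G) i j + s * x + t * A² G i j + + 2 * c * y) (Σ-δ i (λ k → A G k j)) column-sum ⟩
    κ * (∣A∣ G ⊙ A G) i j + s * A G i j + t * A² G i j + + 2 * c * ρ
      ≡⟨ reassociate (κ * (∣A∣ G ⊙ A G) i j) (s * A G i j) (t * A² G i j) (+ 2 * c * ρ) ⟩
    κ * (∣A∣ G ⊙ A G) i j + R i j ∎
    where
    open ≡-Reasoning
    reassociate : ∀ x y z w → x + y + z + w ≡ x + (y + z + w)
    reassociate = solve-∀
    column-sum : Σℤ n (λ k → A G k j) ≡ ρ
    column-sum = trans (Σ-cong (λ k → A-sym G k j)) (net j)
    term : ∀ k → + 2 * (A² G i k * A G k j) ≡ κ * (∣A∣ G i k * A G k j) + s * (δ i k * A G k j) + t * (A G i k * A G k j) + + 2 * c * A G k j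
    term k = begin
      + 2 * (A² G i k * A G k j)                                      ≡⟨ *-assoc (+ 2) (A² G i k) _ ⟨
      + 2 * A² G i k * A G k j                                        ≡⟨ cong (_* A G k j) (2*A²≡κ∣A∣+sδ+tA+2c i k) ⟩
      (κ * ∣A∣ G i k + s * δ i k + t * A G i k + + 2 * c) * A G k j
        ≡⟨ expandʳ (A G k j) (∣A∣ G i k) (δ i k) (A G i k) κ s t (+ 2 * c) ⟩
      κ * (∣A∣ G i k * A G k j) + s * (δ i k * A G k j) + t * (A G i k * A G k j) + + 2 * c * A G k j ∎

  A⊙∣A∣≡∣A∣⊙A : ∀ i j → (A G ⊙ ∣A∣ G) i j ≡ (∣A∣ G ⊙ A G) i j
  A⊙∣A∣≡∣A∣⊙A i j = *-cancelˡ-≡ κ _ _ {{≢-nonZero κ≢0}} (+-cancelʳ-≡ (R i j) _ _ (begin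
    κ * (A G ⊙ ∣A∣ G) i j + R i j  ≡⟨ 2*A⊙A²≡κA⊙∣A∣+R i j ⟨
    + 2 * (A G ⊙ A² G) i j         ≡⟨ cong (_*_ (+ 2)) (⊙-assoc (A G) (A G) (A G) i j) ⟨
    + 2 * (A² G ⊙ A G) i j         ≡⟨ 2*A²⊙A≡κ∣A∣⊙A+R i j ⟩
    κ * (∣A∣ G ⊙ A G) i j + R i j  ∎))
    where
    open ≡-Reasoning
    κ≢0 : κ ≢ + 0
    κ≢0 κ≡0 = a+b≢2c (i-j≡0⇒i≡j (a + b) (+ 2 * c) κ≡0)

module _ {n} (G : SignedGraph n) {a b c : ℤ} where

  classes⇒a+b≢2c : ¬ Complete G → InC1 G a b c ⊎ InC4 G a b c ⊎ InC5 G a b c → a + b ≢ + 2 * c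
  classes⇒a+b≢2c incomplete (inj₁ (_ , _ , inj₁ complete)) _ = incomplete complete
  classes⇒a+b≢2c _ (inj₁ (_ , a≡-b , inj₂ (_ , c≢0))) a+b≡2c =
    c≢0 (*-cancelˡ-≡ (+ 2) c (+ 0) (trans (sym a+b≡2c) (trans (cong (_+ b) a≡-b) (+-inverseˡ b))))
  classes⇒a+b≢2c _ (inj₂ (inj₁ (_ , a≢-b , _ , c≡0))) a+b≡2c =
    a≢-b (+≡0⇒≡- a b (trans a+b≡2c (cong (_*_ (+ 2)) c≡0)))
  classes⇒a+b≢2c _ (inj₂ (inj₂ (_ , _ , _ , 2c≢a+b , _))) a+b≡2c = 2c≢a+b (sym a+b≡2c)

-- Negative edges when b = r − 1

module _ {n} (G : SignedGraph n) {r : ℕ} (regular : ∀ v → Σℤ n (∣A∣ G v) ≡ + r) where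

  A²≡r-1⇒twins : ∀ {i j} → ∣A∣ G i j ≡ + 1 → A² G i j ≡ + r - + 1 →
                 ∀ k → i ≢ k → ∣A∣ G j k ≡ + 1 → A G i k ≡ A G k j
  A²≡r-1⇒twins {i} {j} ∣A∣ij≡1 A²ij≡r-1 k i≢k ∣A∣jk≡1 =
    A*A≡1⇒A≡A G i k j (trans (tight k) (cong₂ _-_ ∣A∣jk≡1 (δ-≢ i≢k)))
    where
    bound : ∀ k → A G i k * A G k j ≤ ∣A∣ G j k - δ i k
    bound k with i Fin.≟ k
    ... | yes refl = begin
      A G i i * A G i j  ≡⟨ cong (_* A G i j) (A-irrefl G i) ⟩
      + 0 * A G i j      ≡⟨ *-zeroˡ (A G i j) ⟩
      + 0                ≡⟨ cong (_- + 1) (trans (∣A∣-sym G j i) ∣A∣ij≡1) ⟨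
      ∣A∣ G j i - + 1    ∎
      where open ≤-Reasoning
    ... | no _ = begin
      A G i k * A G k j  ≤⟨ A*A≤∣A∣ G i k j ⟩
      ∣A∣ G k j          ≡⟨ ∣A∣-sym G k j ⟩
      ∣A∣ G j k          ≡⟨ +-identityʳ (∣A∣ G j k) ⟨
      ∣A∣ G j k - + 0    ∎
      where open ≤-Reasoning
    tight : ∀ k → A G i k * A G k j ≡ ∣A∣ G j k - δ i k
    tight = Σ-mono-≤-≡⇒≡ bound (begin
      A² G i j                            ≡⟨ A²ij≡r-1 ⟩
      + r - + 1                           ≡⟨ cong₂ _-_ (regular j) (Σ-δ₁ i) ⟨
      Σℤ n (∣A∣ G j) - Σℤ n (δ i)         ≡⟨ Σ-distrib-- n (∣A∣ G j) (δ i) ⟨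
      Σℤ n (λ k → ∣A∣ G j k - δ i k)      ∎)
      where open ≡-Reasoning

module NegativeEdgeTwins {n} (G : SignedGraph n) {r : ℕ} (regular : ∀ v → Σℤ n (∣A∣ G v) ≡ + r)
  (A²-neg : ∀ i j → NegEdge G i j → A² G i j ≡ + r - + 1) where

  A⁻-euclidean : ∀ {x y z} → A⁻ G z x ≡ + 1 → A⁻ G z y ≡ + 1 → x ≢ y → A⁻ G x y ≡ + 1
  A⁻-euclidean {x} {y} {z} A⁻zx≡1 A⁻zy≡1 x≢y = A≡-1⇒A⁻≡1 G (begin
    A G x y  ≡⟨ A²≡r-1⇒twins G regular (NegEdge⇒∣A∣≡1 G xz) (A²-neg x z xz) y x≢y (NegEdge⇒∣A∣≡1 G zy) ⟩
    A G y z  ≡⟨ A-sym G y z ⟩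
    A G z y  ≡⟨ NegEdge⇒A≡-1 G zy ⟩
    - + 1    ∎)
    where
    open ≡-Reasoning
    xz : NegEdge G x z
    xz = NegEdge-sym G (A⁻≡1⇒NegEdge G A⁻zx≡1)
    zy : NegEdge G z y
    zy = A⁻≡1⇒NegEdge G A⁻zy≡1

  A⁺∘A⁻⊆A⁺ : ∀ {u y z} → A⁺ G u y ≡ + 1 → A⁻ G y z ≡ + 1 → A⁺ G u z ≡ + 1
  A⁺∘A⁻⊆A⁺ {u} {y} {z} uy yz = trans (A⁺-sym G u z) (A≡1⇒A⁺≡1 G (begin
    A G z u  ≡⟨ A²≡r-1⇒twins G regular (NegEdge⇒∣A∣≡1 G zy) (A²-neg z y zy) u z≢u yu ⟩
    A G u y  ≡⟨ A⁺≡1⇒A≡1 G uy ⟩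
    + 1      ∎))
    where
    open ≡-Reasoning
    zy : NegEdge G z y
    zy = NegEdge-sym G (A⁻≡1⇒NegEdge G yz)
    yu : ∣A∣ G y u ≡ + 1
    yu = trans (∣A∣-sym G y u) (A⁺≡1⇒∣A∣≡1 G uy)
    z≢u : z ≢ u
    z≢u refl = 1≢0 (trans (sym yz) (A⁺≡1⇒A⁻≡0 G (trans (A⁺-sym G y z) uy)))

-- Around a negative triangle

module _ {n} (G : SignedGraph n) (regular : Regular G 6) (net : NetRegular G (+ 2)) where

  Σ∣A∣≡6 : ∀ v → Σℤ n (∣A∣ G v) ≡ + 6
  Σ∣A∣≡6 v = trans (Σ∣A∣≡degree G v) (cong +_ (regular v))

  ΣA⁻≡2 : ∀ v → Σℤ n (A⁻ G v) ≡ + 2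
  ΣA⁻≡2 v = *-cancelˡ-≡ (+ 2) _ (+ 2)
    (trans (2*ΣA⁻≡degree-netDegree G v) (cong₂ _-_ (cong +_ (regular v)) (net v)))

  ΣA⁺≡4 : ∀ v → Σℤ n (A⁺ G v) ≡ + 4
  ΣA⁺≡4 v = *-cancelˡ-≡ (+ 2) _ (+ 4)
    (trans (2*ΣA⁺≡degree+netDegree G v) (cong₂ _+_ (cong +_ (regular v)) (net v)))

-- What a = d − 3m with m ≤ d ≤ 3 and m ∈ {0, 1, 2} allows, split by m.
data Profile (a d m : ℤ) : Set where
  untouched     : m ≡ + 0 → + 0 ≤ a → a ≤ + 3 → (a ≡ + 0 → d ≡ + 0) → Profile a d m
  touched-once  : m ≡ + 1 → - + 2 ≤ a → a ≤ + 0 → (a ≡ + 0 → d ≡ + 3) → Profile a d m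
  touched-twice : m ≡ + 2 → a ≤ - + 3 → Profile a d m

profile : ∀ {a d e f} → Bit e → Bit f → + 0 ≤ d → d ≤ + 3 →
          - d ≤ d - + 2 * (e + f) → a ≡ d - + 3 * (e + f) → Profile a d (e + f)
profile {d = + 0} (inj₁ refl) (inj₁ refl) _ _ _ refl = untouched refl ≤-decide ≤-decide (λ _ → refl)
profile {d = + 0} (inj₁ refl) (inj₂ refl) _ _ -d≤d-2m refl = ⊥-elim (≰-decide -d≤d-2m)
profile {d = + 0} (inj₂ refl) (inj₁ refl) _ _ -d≤d-2m refl = ⊥-elim (≰-decide -d≤d-2m)
profile {d = + 0} (inj₂ refl) (inj₂ refl) _ _ -d≤d-2m refl = ⊥-elim (≰-decide -d≤d-2m)
profile {d = + 1} (inj₁ refl) (inj₁ refl) _ _ _ refl = untouched refl ≤-decide ≤-decide (λ ())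
profile {d = + 1} (inj₁ refl) (inj₂ refl) _ _ _ refl = touched-once refl ≤-decide ≤-decide (λ ())
profile {d = + 1} (inj₂ refl) (inj₁ refl) _ _ _ refl = touched-once refl ≤-decide ≤-decide (λ ())
profile {d = + 1} (inj₂ refl) (inj₂ refl) _ _ -d≤d-2m refl = ⊥-elim (≰-decide -d≤d-2m)
profile {d = + 2} (inj₁ refl) (inj₁ refl) _ _ _ refl = untouched refl ≤-decide ≤-decide (λ ())
profile {d = + 2} (inj₁ refl) (inj₂ refl) _ _ _ refl = touched-once refl ≤-decide ≤-decide (λ ())
profile {d = + 2} (inj₂ refl) (inj₁ refl) _ _ _ refl = touched-once refl ≤-decide ≤-decide (λ ())
profile {d = + 2} (inj₂ refl) (inj₂ refl) _ _ _ refl = touched-twice refl ≤-decide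
profile {d = + 3} (inj₁ refl) (inj₁ refl) _ _ _ refl = untouched refl ≤-decide ≤-decide (λ ())
profile {d = + 3} (inj₁ refl) (inj₂ refl) _ _ _ refl = touched-once refl ≤-decide ≤-decide (λ _ → refl)
profile {d = + 3} (inj₂ refl) (inj₁ refl) _ _ _ refl = touched-once refl ≤-decide ≤-decide (λ _ → refl)
profile {d = + 3} (inj₂ refl) (inj₂ refl) _ _ _ refl = touched-twice refl ≤-decide
profile {d = + suc (suc (suc (suc _)))} _ _ _ (+≤+ (ℕ.s≤s (ℕ.s≤s (ℕ.s≤s ())))) _ _
profile {d = -[1+ _ ]} _ _ () _ _ _

Profile⇒1≤a⇒m≡0 : ∀ {a d m} → Profile a d m → + 1 ≤ a → m ≡ + 0
Profile⇒1≤a⇒m≡0 (untouched m≡0 _ _ _)     _   = m≡0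
Profile⇒1≤a⇒m≡0 (touched-once _ _ a≤0 _)  1≤a = ⊥-elim (≰-decide (≤-trans 1≤a a≤0))
Profile⇒1≤a⇒m≡0 (touched-twice _ a≤-3)    1≤a = ⊥-elim (≰-decide (≤-trans 1≤a a≤-3))

Profile⇒-2≤a≤-1⇒m≡1 : ∀ {a d m} → Profile a d m → - + 2 ≤ a → a ≤ - + 1 → m ≡ + 1
Profile⇒-2≤a≤-1⇒m≡1 (untouched _ 0≤a _ _)    _     a≤-1 = ⊥-elim (≰-decide (≤-trans 0≤a a≤-1))
Profile⇒-2≤a≤-1⇒m≡1 (touched-once m≡1 _ _ _) _     _    = m≡1
Profile⇒-2≤a≤-1⇒m≡1 (touched-twice _ a≤-3)   -2≤a  _    = ⊥-elim (≰-decide (≤-trans -2≤a a≤-3))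

Profile⇒a≤-3⇒m≡2 : ∀ {a d m} → Profile a d m → a ≤ - + 3 → m ≡ + 2
Profile⇒a≤-3⇒m≡2 (untouched _ 0≤a _ _)      a≤-3 = ⊥-elim (≰-decide (≤-trans 0≤a a≤-3))
Profile⇒a≤-3⇒m≡2 (touched-once _ -2≤a _ _)  a≤-3 = ⊥-elim (≰-decide (≤-trans -2≤a a≤-3))
Profile⇒a≤-3⇒m≡2 (touched-twice m≡2 _)      _    = m≡2

Profile⇒a≡0 : ∀ {a d m} → Profile a d m → a ≡ + 0 → (m ≡ + 0 × d ≡ + 0) ⊎ (m ≡ + 1 × d ≡ + 3)
Profile⇒a≡0 (untouched m≡0 _ _ d≡0)    a≡0 = inj₁ (m≡0 , d≡0 a≡0)
Profile⇒a≡0 (touched-once m≡1 _ _ d≡3) a≡0 = inj₂ (m≡1 , d≡3 a≡0)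
Profile⇒a≡0 (touched-twice _ a≤-3)     refl = ⊥-elim (≰-decide a≤-3)

module NegativeTriangle {n} (G : SignedGraph n) (regular : Regular G 6) (net : NetRegular G (+ 2))
  {a b : ℤ} (A²-pos : ∀ i j → PosEdge G i j → A² G i j ≡ a) (A²-neg : ∀ i j → NegEdge G i j → A² G i j ≡ b)
  (commute : ∀ i j → (A G ⊙ ∣A∣ G) i j ≡ (∣A∣ G ⊙ A G) i j)
  {u v w : Fin n} (uv : NegEdge G u v) (vw : NegEdge G v w) (uw : NegEdge G u w) where

  d S m : Fin n → ℤ
  d x = Σℤ n (λ k → A⁺ G u k * ∣A∣ G k x)
  S x = Σℤ n (λ k → A⁺ G u k * A G k x)
  m x = ∣A∣ G v x + ∣A∣ G w x

  A⁻u≡δv+δw : ∀ k → A⁻ G u k ≡ δ v k + δ w k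
  A⁻u≡δv+δw = ≡δ+δ (NegEdge⇒≢ G vw) (λ k → Bit⇒0≤ (A⁻-bit G u k))
    (NegEdge⇒A⁻≡1 G uv) (NegEdge⇒A⁻≡1 G uw) (ΣA⁻≡2 G regular net u)

  A⁻v≡δu+δw : ∀ k → A⁻ G v k ≡ δ u k + δ w k
  A⁻v≡δu+δw = ≡δ+δ (NegEdge⇒≢ G uw) (λ k → Bit⇒0≤ (A⁻-bit G v k))
    (NegEdge⇒A⁻≡1 G (NegEdge-sym G uv)) (NegEdge⇒A⁻≡1 G vw) (ΣA⁻≡2 G regular net v)

  A⁻w≡δu+δv : ∀ k → A⁻ G w k ≡ δ u k + δ v k
  A⁻w≡δu+δv = ≡δ+δ (NegEdge⇒≢ G uv) (λ k → Bit⇒0≤ (A⁻-bit G w k))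
    (NegEdge⇒A⁻≡1 G (NegEdge-sym G uw)) (NegEdge⇒A⁻≡1 G (NegEdge-sym G vw)) (ΣA⁻≡2 G regular net w)

  A⊙-row : ∀ (M : Fin n → Fin n → ℤ) j → (A G ⊙ M) u j ≡ Σℤ n (λ k → A⁺ G u k * M k j) - (M v j + M w j)
  A⊙-row M j = begin
    Σℤ n (λ k → A G u k * M k j)                                 ≡⟨ Σ-cong entry ⟩
    Σℤ n (λ k → A⁺ G u k * M k j - (δ v k + δ w k) * M k j)      ≡⟨ Σ-distrib-- n _ _ ⟩
    ΣA⁺M - Σℤ n (λ k → (δ v k + δ w k) * M k j)                  ≡⟨ cong (_-_ ΣA⁺M) (Σ-δ+δ v w (λ k → M k j)) ⟩
    ΣA⁺M - (M v j + M w j)                                       ∎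
    where
    open ≡-Reasoning
    ΣA⁺M : ℤ
    ΣA⁺M = Σℤ n (λ k → A⁺ G u k * M k j)
    entry : ∀ k → A G u k * M k j ≡ A⁺ G u k * M k j - (δ v k + δ w k) * M k j
    entry k = trans (cong (_* M k j) (trans (A≡A⁺-A⁻ G u k) (cong (_-_ (A⁺ G u k)) (A⁻u≡δv+δw k))))
                    ([y-z]x≈yx-zx (M k j) (A⁺ G u k) (δ v k + δ w k))

  ∣A∣⊙-row : ∀ (M : Fin n → Fin n → ℤ) j → (∣A∣ G ⊙ M) u j ≡ Σℤ n (λ k → A⁺ G u k * M k j) + (M v j + M w j)
  ∣A∣⊙-row M j = begin
    Σℤ n (λ k → ∣A∣ G u k * M k j)                               ≡⟨ Σ-cong entry ⟩
    Σℤ n (λ k → A⁺ G u k * M k j + (δ v k + δ w k) * M k j)      ≡⟨ Σ-distrib-+ n _ _ ⟩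
    ΣA⁺M + Σℤ n (λ k → (δ v k + δ w k) * M k j)                  ≡⟨ cong (_+_ ΣA⁺M) (Σ-δ+δ v w (λ k → M k j)) ⟩
    ΣA⁺M + (M v j + M w j)                                       ∎
    where
    open ≡-Reasoning
    ΣA⁺M : ℤ
    ΣA⁺M = Σℤ n (λ k → A⁺ G u k * M k j)
    entry : ∀ k → ∣A∣ G u k * M k j ≡ A⁺ G u k * M k j + (δ v k + δ w k) * M k j
    entry k = trans (cong (_* M k j) (trans (∣A∣≡A⁺+A⁻ G u k) (cong (_+_ (A⁺ G u k)) (A⁻u≡δv+δw k))))
                    (*-distribʳ-+ (M k j) (A⁺ G u k) (δ v k + δ w k))

  0≤d : ∀ x → + 0 ≤ d x
  0≤d x = subst (_≤ d x) (Σ-zero n)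
    (Σ-mono-≤ (λ k → Bit-*-nonneg (A⁺-bit G u k) (Bit⇒0≤ (∣A∣-bit G k x))))

  ΣA⁺u-δ≡3 : ∀ x → Σℤ n (λ k → A⁺ G u k - δ x k) ≡ + 3
  ΣA⁺u-δ≡3 x = trans (Σ-distrib-- n (A⁺ G u) (δ x)) (cong₂ _-_ (ΣA⁺≡4 G regular net u) (Σ-δ₁ x))

  d-term≤ : ∀ {x} → A⁺ G u x ≡ + 1 → ∀ k → A⁺ G u k * ∣A∣ G k x ≤ A⁺ G u k - δ x k
  d-term≤ {x} ux k with x Fin.≟ k
  ... | yes refl rewrite ux | ∣A∣-irrefl G x = ≤-refl
  ... | no _ = subst (A⁺ G u k * ∣A∣ G k x ≤_) (sym (+-identityʳ (A⁺ G u k))) (Bit-*-≤ (A⁺-bit G u k) (Bit⇒≤1 (∣A∣-bit G k x)))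

  d≤3 : ∀ {x} → A⁺ G u x ≡ + 1 → d x ≤ + 3
  d≤3 {x} ux = subst (d x ≤_) (ΣA⁺u-δ≡3 x) (Σ-mono-≤ (d-term≤ ux))

  d≡3⇒saturated : ∀ {x} → A⁺ G u x ≡ + 1 → d x ≡ + 3 → ∀ k → A⁺ G u k ≡ + 1 → x ≢ k → ∣A∣ G k x ≡ + 1
  d≡3⇒saturated {x} ux d≡3 k uk x≢k = begin
    ∣A∣ G k x                  ≡⟨ *-identityˡ (∣A∣ G k x) ⟨
    + 1 * ∣A∣ G k x            ≡⟨ cong (_* ∣A∣ G k x) uk ⟨
    A⁺ G u k * ∣A∣ G k x       ≡⟨ Σ-mono-≤-≡⇒≡ (d-term≤ ux) (trans d≡3 (sym (ΣA⁺u-δ≡3 x))) k ⟩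
    A⁺ G u k - δ x k           ≡⟨ cong₂ _-_ uk (δ-≢ x≢k) ⟩
    + 1                        ∎
    where open ≡-Reasoning

  -d≤S : ∀ x → - d x ≤ S x
  -d≤S x = subst (_≤ S x) (sym (neg-distrib-Σ n _)) (Σ-mono-≤ term)
    where
    term : ∀ k → - (A⁺ G u k * ∣A∣ G k x) ≤ A⁺ G u k * A G k x
    term k with A⁺-bit G u k
    ... | inj₁ uk≡0 rewrite uk≡0 = ≤-refl
    ... | inj₂ uk≡1 rewrite uk≡1 | *-identityˡ (∣A∣ G k x) | *-identityˡ (A G k x) = -∣A∣≤A G k x

  module _ {x} (ux : A⁺ G u x ≡ + 1) where

    u≢x : u ≢ x
    u≢x refl = 1≢0 (trans (sym ux) (A⁺-irrefl G u))

    v≢x : v ≢ x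
    v≢x refl = 1≢0 (trans (sym (NegEdge⇒A⁻≡1 G uv)) (A⁺≡1⇒A⁻≡0 G ux))

    w≢x : w ≢ x
    w≢x refl = 1≢0 (trans (sym (NegEdge⇒A⁻≡1 G uw)) (A⁺≡1⇒A⁻≡0 G ux))

    A⁻vx≡0 : A⁻ G v x ≡ + 0
    A⁻vx≡0 = trans (A⁻v≡δu+δw x) (cong₂ _+_ (δ-≢ u≢x) (δ-≢ w≢x))

    Avx≡∣A∣vx : A G v x ≡ ∣A∣ G v x
    Avx≡∣A∣vx = A⁻≡0⇒A≡∣A∣ G A⁻vx≡0

    Awx≡∣A∣wx : A G w x ≡ ∣A∣ G w x
    Awx≡∣A∣wx = A⁻≡0⇒A≡∣A∣ G (trans (A⁻w≡δu+δv x) (cong₂ _+_ (δ-≢ u≢x) (δ-≢ v≢x)))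

    A²≡S-m : A² G u x ≡ S x - m x
    A²≡S-m = trans (A⊙-row (A G) x) (cong (_-_ (S x)) (cong₂ _+_ Avx≡∣A∣vx Awx≡∣A∣wx))

    d-m≡S+m : d x - m x ≡ S x + m x
    d-m≡S+m = begin
      d x - m x               ≡⟨ A⊙-row (∣A∣ G) x ⟨
      (A G ⊙ ∣A∣ G) u x       ≡⟨ commute u x ⟩
      (∣A∣ G ⊙ A G) u x       ≡⟨ ∣A∣⊙-row (A G) x ⟩
      S x + (A G v x + A G w x) ≡⟨ cong (_+_ (S x)) (cong₂ _+_ Avx≡∣A∣vx Awx≡∣A∣wx) ⟩
      S x + m x               ∎
      where open ≡-Reasoning

    S≡d-2m : S x ≡ d x - + 2 * m x
    S≡d-2m = begin
      S x                     ≡⟨ cancel (S x) (m x) ⟩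
      S x + m x - m x         ≡⟨ cong (_- m x) d-m≡S+m ⟨
      d x - m x - m x         ≡⟨ collect (d x) (m x) ⟩
      d x - + 2 * m x         ∎
      where
      open ≡-Reasoning
      cancel : ∀ s m → s ≡ s + m - m
      cancel = solve-∀
      collect : ∀ d m → d - m - m ≡ d - + 2 * m
      collect = solve-∀

    a≡d-3m : a ≡ d x - + 3 * m x
    a≡d-3m = begin
      a                       ≡⟨ A²-pos u x (A⁺≡1⇒PosEdge G ux) ⟨
      A² G u x                ≡⟨ A²≡S-m ⟩
      S x - m x               ≡⟨ cong (_- m x) S≡d-2m ⟩
      d x - + 2 * m x - m x   ≡⟨ collect (d x) (m x) ⟩
      d x - + 3 * m x         ∎
      where
      open ≡-Reasoning
      collect : ∀ d m → d - + 2 * m - m ≡ d - + 3 * m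
      collect = solve-∀

    profile-of : Profile a (d x) (m x)
    profile-of = profile (∣A∣-bit G v x) (∣A∣-bit G w x) (0≤d x) (d≤3 ux)
      (subst (- d x ≤_) S≡d-2m (-d≤S x)) a≡d-3m

  b≡dv+1 : b ≡ d v + + 1
  b≡dv+1 = begin
    b                                                     ≡⟨ A²-neg u v uv ⟨
    A² G u v                                              ≡⟨ A⊙-row (A G) v ⟩
    Σℤ n (λ k → A⁺ G u k * A G k v) - (A G v v + A G w v) ≡⟨ cong₂ _-_ (Σ-cong term) (cong₂ _+_ (A-irrefl G v) Awv≡-1) ⟩
    d v + + 1                                             ∎
    where
    open ≡-Reasoning
    Awv≡-1 : A G w v ≡ - + 1
    Awv≡-1 = trans (A-sym G w v) (NegEdge⇒A≡-1 G vw)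
    term : ∀ k → A⁺ G u k * A G k v ≡ A⁺ G u k * ∣A∣ G k v
    term k = Bit-*-cong (A⁺-bit G u k) (λ uk → trans (A-sym G k v) (trans (Avx≡∣A∣vx uk) (∣A∣-sym G v k)))

  ΣA⁺m≡dv+dw : Σℤ n (λ x → A⁺ G u x * m x) ≡ d v + d w
  ΣA⁺m≡dv+dw = trans (Σ-cong term) (Σ-distrib-+ n _ _)
    where
    term : ∀ x → A⁺ G u x * m x ≡ A⁺ G u x * ∣A∣ G x v + A⁺ G u x * ∣A∣ G x w
    term x = trans (*-distribˡ-+ (A⁺ G u x) (∣A∣ G v x) (∣A∣ G w x))
                   (cong₂ _+_ (cong (_*_ (A⁺ G u x)) (∣A∣-sym G v x)) (cong (_*_ (A⁺ G u x)) (∣A∣-sym G w x)))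

module NegativeTriangleParameters {n} (G : SignedGraph n) (regular : Regular G 6) (net : NetRegular G (+ 2))
  {a b : ℤ} (A²-pos : ∀ i j → PosEdge G i j → A² G i j ≡ a) (A²-neg : ∀ i j → NegEdge G i j → A² G i j ≡ b)
  (commute : ∀ i j → (A G ⊙ ∣A∣ G) i j ≡ (∣A∣ G ⊙ A G) i j)
  {u v w : Fin n} (uv : NegEdge G u v) (vw : NegEdge G v w) (uw : NegEdge G u w) where

  open NegativeTriangle G regular net A²-pos A²-neg commute uv vw uw
  private
    module W = NegativeTriangle G regular net A²-pos A²-neg commute uw (NegEdge-sym G vw) uv
    module V = NegativeTriangle G regular net A²-pos A²-neg commute (NegEdge-sym G uv) uw vw

  positive-neighbour : ∃ λ x → A⁺ G u x ≡ + 1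
  positive-neighbour =
    let x , 0<ux = Σ-<⇒∃< (subst₂ _<_ (sym (Σ-zero n)) (sym (ΣA⁺≡4 G regular net u)) <-decide)
    in x , Bit-0<⇒≡1 (A⁺-bit G u x) 0<ux

  b≡2μ+1 : ∀ μ → (∀ x → A⁺ G u x ≡ + 1 → m x ≡ μ) → b ≡ + 2 * μ + + 1
  b≡2μ+1 μ uniform = *-cancelˡ-≡ (+ 2) b (+ 2 * μ + + 1) (begin
    + 2 * b                            ≡⟨ double b ⟩
    b + b                              ≡⟨ cong₂ _+_ b≡dv+1 W.b≡dv+1 ⟩
    d v + + 1 + (d w + + 1)            ≡⟨ regroup (d v) (d w) ⟩
    d v + d w + + 2                    ≡⟨ cong (_+ + 2) ΣA⁺m≡dv+dw ⟨
    Σℤ n (λ x → A⁺ G u x * m x) + + 2  ≡⟨ cong (_+ + 2) (Σ-cong (λ x → Bit-*-cong (A⁺-bit G u x) (uniform x))) ⟩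
    Σℤ n (λ x → A⁺ G u x * μ) + + 2    ≡⟨ cong (_+ + 2) (*-distribʳ-Σ n μ (A⁺ G u)) ⟨
    Σℤ n (A⁺ G u) * μ + + 2            ≡⟨ cong (λ s → s * μ + + 2) (ΣA⁺≡4 G regular net u) ⟩
    + 4 * μ + + 2                      ≡⟨ factor μ ⟩
    + 2 * (+ 2 * μ + + 1)              ∎)
    where
    open ≡-Reasoning
    double : ∀ b → + 2 * b ≡ b + b
    double = solve-∀
    regroup : ∀ x y → x + + 1 + (y + + 1) ≡ x + y + + 2
    regroup = solve-∀
    factor : ∀ μ → + 4 * μ + + 2 ≡ + 2 * (+ 2 * μ + + 1)
    factor = solve-∀

  1≤a⇒b≡1 : + 1 ≤ a → b ≡ + 1
  1≤a⇒b≡1 1≤a = b≡2μ+1 (+ 0) (λ x ux → Profile⇒1≤a⇒m≡0 (profile-of ux) 1≤a)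

  -2≤a≤-1⇒b≡3 : - + 2 ≤ a → a ≤ - + 1 → b ≡ + 3
  -2≤a≤-1⇒b≡3 -2≤a a≤-1 = b≡2μ+1 (+ 1) (λ x ux → Profile⇒-2≤a≤-1⇒m≡1 (profile-of ux) -2≤a a≤-1)

  far-positive-neighbour : ∀ {x} → A⁺ G u x ≡ + 1 → ∃ λ y → A⁺ G u y ≡ + 1 × x ≢ y × A⁻ G x y ≡ + 0
  far-positive-neighbour {x} ux =
    let y , δ+A⁻<A⁺ = Σ-<⇒∃< {f = λ k → δ x k + A⁻ G x k} {g = A⁺ G u} Σ<Σ
        δxy≡0 , A⁻xy≡0 , uy = Bit+Bit<Bit (δ-bit x y) (A⁻-bit G x y) (A⁺-bit G u y) δ+A⁻<A⁺
    in y , uy , (λ x≡y → 1≢0 (trans (sym (δ-refl x)) (trans (cong (δ x) x≡y) δxy≡0))) , A⁻xy≡0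
    where
    Σ<Σ : Σℤ n (λ k → δ x k + A⁻ G x k) < Σℤ n (A⁺ G u)
    Σ<Σ = subst₂ _<_ (sym (trans (Σ-distrib-+ n (δ x) (A⁻ G x)) (cong₂ _+_ (Σ-δ₁ x) (ΣA⁻≡2 G regular net x))))
                     (sym (ΣA⁺≡4 G regular net u)) <-decide

  module _ (A²-neg≡5 : ∀ i j → NegEdge G i j → A² G i j ≡ + 6 - + 1) where
    open NegativeEdgeTwins G (Σ∣A∣≡6 G regular net) A²-neg≡5

    disjoint-negative-stars⇒⊥ : ∀ {x y} → A⁺ G u x ≡ + 1 → A⁺ G u y ≡ + 1 → x ≢ y → A⁻ G x y ≡ + 0 → ⊥
    disjoint-negative-stars⇒⊥ {x} {y} ux uy x≢y A⁻xy≡0 =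
      six≰four six≤four
      where
      six≰four : ¬ (+ 6 ≤ + 4)
      six≰four = ≰-decide
      Σstars≡6 : Σℤ n (λ k → A⁻ G y k + A⁻ G x k + (δ x k + δ y k)) ≡ + 6
      Σstars≡6 = trans (Σ-distrib-+ n _ _) (cong₂ _+_
        (trans (Σ-distrib-+ n (A⁻ G y) (A⁻ G x)) (cong₂ _+_ (ΣA⁻≡2 G regular net y) (ΣA⁻≡2 G regular net x)))
        (trans (Σ-distrib-+ n (δ x) (δ y)) (cong₂ _+_ (Σ-δ₁ x) (Σ-δ₁ y))))
      bound : ∀ k → A⁻ G y k + A⁻ G x k + (δ x k + δ y k) ≤ A⁺ G u k
      bound k with x Fin.≟ k | y Fin.≟ k
      ... | yes refl | yes refl = ⊥-elim (x≢y refl)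
      ... | yes refl | no _ rewrite trans (A⁻-sym G y x) A⁻xy≡0 | A⁻-irrefl G x | ux = ≤-refl
      ... | no _ | yes refl rewrite A⁻-irrefl G y | A⁻xy≡0 | uy = ≤-refl
      ... | no _ | no _ = subst (_≤ A⁺ G u k) (sym (+-identityʳ _))
        (Bit-disjoint-≤ (A⁻-bit G y k) (A⁻-bit G x k) (A⁺-bit G u k)
          (λ yk xk → 1≢0 (trans (sym (A⁻-euclidean (trans (A⁻-sym G k x) xk) (trans (A⁻-sym G k y) yk) x≢y)) A⁻xy≡0))
          (A⁺∘A⁻⊆A⁺ uy)
          (A⁺∘A⁻⊆A⁺ ux))
      six≤four : + 6 ≤ + 4
      six≤four = subst₂ _≤_ Σstars≡6 (ΣA⁺≡4 G regular net u) (Σ-mono-≤ bound)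

  a≤-3⇒b≡5 : a ≤ - + 3 → b ≡ + 5
  a≤-3⇒b≡5 a≤-3 = b≡2μ+1 (+ 2) (λ x ux → Profile⇒a≤-3⇒m≡2 (profile-of ux) a≤-3)

  a≤-3⇒⊥ : a ≤ - + 3 → ⊥
  a≤-3⇒⊥ a≤-3 =
    let x , ux = positive-neighbour
        y , uy , x≢y , A⁻xy≡0 = far-positive-neighbour ux
    in disjoint-negative-stars⇒⊥ (λ i j ij → trans (A²-neg i j ij) (a≤-3⇒b≡5 a≤-3)) ux uy x≢y A⁻xy≡0

  b≢1⇒touched : b ≢ + 1 → ∃ λ y → A⁺ G u y ≡ + 1 × ∣A∣ G v y ≡ + 1
  b≢1⇒touched b≢1 =
    let y , 0<uy*yv = Σ-<⇒∃< {f = λ _ → + 0} (subst (_< d v) (sym (Σ-zero n)) 0<dv)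
        uy , yv = Bit*Bit-0<⇒≡1 (A⁺-bit G u y) (∣A∣-bit G y v) 0<uy*yv
    in y , uy , trans (∣A∣-sym G v y) yv
    where
    0<dv : + 0 < d v
    0<dv = ≤∧≢⇒< (0≤d v) (λ 0≡dv → b≢1 (trans b≡dv+1 (cong (_+ + 1) (sym 0≡dv))))

  doubly-saturated⇒⊥ : ∀ {y} → A⁺ G u y ≡ + 1 → A⁺ G v y ≡ + 1 →
    (∀ k → A⁺ G u k ≡ + 1 → y ≢ k → ∣A∣ G k y ≡ + 1) →
    (∀ k → A⁺ G v k ≡ + 1 → y ≢ k → ∣A∣ G k y ≡ + 1) →
    Σℤ n (λ k → A⁺ G u k * A⁺ G v k) ≡ + 2 → ⊥
  doubly-saturated⇒⊥ {y} uy vy saturated-u saturated-v ΣA⁺uA⁺v≡2 = ten≰nine ten≤nine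
    where
    ten≰nine : ¬ (+ 10 ≤ + 9)
    ten≰nine = ≰-decide
    bound : ∀ k → A⁺ G u k + A⁺ G v k + (δ u k + δ v k) ≤ ∣A∣ G y k + A⁺ G u k * A⁺ G v k + δ y k
    bound k with u Fin.≟ k | v Fin.≟ k | y Fin.≟ k
    ... | yes refl | yes refl | _        = ⊥-elim (NegEdge⇒≢ G uv refl)
    ... | yes refl | _        | yes refl = ⊥-elim (u≢x uy refl)
    ... | _        | yes refl | yes refl = ⊥-elim (v≢x uy refl)
    ... | yes refl | no _     | no _
      rewrite A⁺-irrefl G u | NegEdge⇒A⁺≡0 G (NegEdge-sym G uv) | trans (∣A∣-sym G y u) (A⁺≡1⇒∣A∣≡1 G uy) = ≤-refl
    ... | no _     | yes refl | no _
      rewrite A⁺-irrefl G v | NegEdge⇒A⁺≡0 G uv | trans (∣A∣-sym G y v) (A⁺≡1⇒∣A∣≡1 G vy) = ≤-refl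
    ... | no _     | no _     | yes refl rewrite uy | vy | ∣A∣-irrefl G y = ≤-refl
    ... | no _     | no _     | no y≢k   = subst₂ _≤_ (sym (+-identityʳ _)) (sym (+-identityʳ _))
      (Bit-union-≤ (A⁺-bit G u k) (A⁺-bit G v k) (∣A∣-bit G y k)
        (λ uk → trans (∣A∣-sym G y k) (saturated-u k uk y≢k))
        (λ vk → trans (∣A∣-sym G y k) (saturated-v k vk y≢k)))
    ten≤nine : + 10 ≤ + 9
    ten≤nine = subst₂ _≤_
      (trans (Σ-distrib-+ n _ _) (cong₂ _+_
        (trans (Σ-distrib-+ n (A⁺ G u) (A⁺ G v)) (cong₂ _+_ (ΣA⁺≡4 G regular net u) (ΣA⁺≡4 G regular net v)))
        (trans (Σ-distrib-+ n (δ u) (δ v)) (cong₂ _+_ (Σ-δ₁ u) (Σ-δ₁ v)))))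
      (trans (Σ-distrib-+ n _ (δ y)) (cong₂ _+_
        (trans (Σ-distrib-+ n (∣A∣ G y) _) (cong₂ _+_ (Σ∣A∣≡6 G regular net y) ΣA⁺uA⁺v≡2))
        (Σ-δ₁ y)))
      (Σ-mono-≤ bound)

  module _ (a≡0 : a ≡ + 0) where

    touched⇒d≡3 : ∀ {D M} → Profile a D M → M ≢ + 0 → D ≡ + 3
    touched⇒d≡3 p M≢0 with Profile⇒a≡0 p a≡0
    ... | inj₁ (M≡0 , _) = ⊥-elim (M≢0 M≡0)
    ... | inj₂ (_ , D≡3) = D≡3

    touched⇒saturated : ∀ {y} → A⁺ G u y ≡ + 1 → ∣A∣ G v y ≡ + 1 →
                        ∀ k → A⁺ G u k ≡ + 1 → y ≢ k → ∣A∣ G k y ≡ + 1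
    touched⇒saturated {y} uy vy = d≡3⇒saturated uy (touched⇒d≡3 (profile-of uy) (1+Bit≢0 vy (∣A∣-bit G w y)))

    touched⇒b≡3 : ∀ {y} → A⁺ G u y ≡ + 1 → ∣A∣ G v y ≡ + 1 → b ≡ + 3
    touched⇒b≡3 {y} uy vy = b≡2μ+1 (+ 1) all-touched-once
      where
      all-touched-once : ∀ x → A⁺ G u x ≡ + 1 → m x ≡ + 1
      all-touched-once x ux = once (Profile⇒a≡0 (profile-of ux) a≡0)
        where
        once : (m x ≡ + 0 × d x ≡ + 0) ⊎ (m x ≡ + 1 × d x ≡ + 3) → m x ≡ + 1
        once (inj₂ (mx≡1 , _))     = mx≡1
        once (inj₁ (mx≡0 , dx≡0)) = ⊥-elim (1≢0 (begin
          + 1                     ≡⟨ cong₂ _*_ uy (trans (∣A∣-sym G y x) (touched⇒saturated uy vy x ux y≢x)) ⟨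
          A⁺ G u y * ∣A∣ G y x    ≡⟨ Σ≡0⇒≡0 (λ k → Bit-*-nonneg (A⁺-bit G u k) (Bit⇒0≤ (∣A∣-bit G k x))) dx≡0 y ⟩
          + 0                     ∎))
          where
          open ≡-Reasoning
          y≢x : y ≢ x
          y≢x refl = 1+Bit≢0 vy (∣A∣-bit G w y) mx≡0

    touched⇒⊥ : ∀ {y} → A⁺ G u y ≡ + 1 → ∣A∣ G v y ≡ + 1 → ⊥
    touched⇒⊥ {y} uy vy = doubly-saturated⇒⊥ uy vy⁺ (touched⇒saturated uy vy)
      (V.d≡3⇒saturated vy⁺ (touched⇒d≡3 (V.profile-of vy⁺) (1+Bit≢0 (A⁺≡1⇒∣A∣≡1 G uy) (∣A∣-bit G w y)))) ΣA⁺uA⁺v≡2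
      where
      vy⁺ : A⁺ G v y ≡ + 1
      vy⁺ = trans (A⁻≡0⇒A⁺≡∣A∣ G (A⁻vx≡0 uy)) vy
      ΣA⁺uA⁺v≡2 : Σℤ n (λ k → A⁺ G u k * A⁺ G v k) ≡ + 2
      ΣA⁺uA⁺v≡2 = begin
        Σℤ n (λ k → A⁺ G u k * A⁺ G v k)  ≡⟨ Σ-cong (λ k → Bit-*-cong (A⁺-bit G u k) (λ uk → trans (A⁻≡0⇒A⁺≡∣A∣ G (A⁻vx≡0 uk)) (∣A∣-sym G v k))) ⟩
        d v                               ≡⟨ +-cancelʳ-≡ (+ 1) (d v) (+ 2) (trans (sym b≡dv+1) (touched⇒b≡3 uy vy)) ⟩
        + 2                               ∎
        where open ≡-Reasoning

    a≡0⇒b≡1 : b ≡ + 1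
    a≡0⇒b≡1 with b ≟ + 1
    ... | yes b≡1 = b≡1
    ... | no b≢1 = let _ , uy , vy = b≢1⇒touched b≢1 in ⊥-elim (touched⇒⊥ uy vy)

  0≤a⇒b≡1 : + 0 ≤ a → b ≡ + 1
  0≤a⇒b≡1 0≤a with a ≟ + 0
  ... | yes a≡0 = a≡0⇒b≡1 a≡0
  ... | no a≢0  = 1≤a⇒b≡1 (0≤i∧i≢0⇒1≤i 0≤a a≢0)

lemma3p14 : (n : ℕ) (G : SignedGraph n) (a b c : ℤ) →
    IsSRSG G 6 a b c →
    (InC1 G a b c ⊎ InC4 G a b c ⊎ InC5 G a b c) →
    Connected G → ¬ Complete G → Regular G 6 → NetRegular G (+ 2) →
    HasNegTriangle G →
    (b ≡ + 1 × + 0 ≤ a × a ≤ + 3) ⊎ (b ≡ + 3 × (a ≡ - (+ 1) ⊎ a ≡ - (+ 2)))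
lemma3p14 n G a b c srsg@(_ , _ , _ , A²-pos , A²-neg , _) classes _ incomplete regular net (u , v , w , uv , vw , uw) =
  by-profile (profile-of (proj₂ positive-neighbour))
  where
  commute : ∀ i j → (A G ⊙ ∣A∣ G) i j ≡ (∣A∣ G ⊙ A G) i j
  commute = A⊙∣A∣≡∣A∣⊙A G srsg net (classes⇒a+b≢2c G incomplete classes)
  open NegativeTriangle G regular net A²-pos A²-neg commute uv vw uw using (profile-of)
  open NegativeTriangleParameters G regular net A²-pos A²-neg commute uv vw uw

  by-profile : ∀ {D M} → Profile a D M → (b ≡ + 1 × + 0 ≤ a × a ≤ + 3) ⊎ (b ≡ + 3 × (a ≡ - (+ 1) ⊎ a ≡ - (+ 2)))
  by-profile (untouched _ 0≤a a≤3 _) = inj₁ (0≤a⇒b≡1 0≤a , 0≤a , a≤3)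
  by-profile (touched-once _ -2≤a a≤0 _) with a ≟ + 0
  ... | yes a≡0 = inj₁ (a≡0⇒b≡1 a≡0 , ≤-reflexive (sym a≡0) , ≤-trans a≤0 ≤-decide)
  ... | no a≢0  = inj₂ (-2≤a≤-1⇒b≡3 -2≤a a≤-1 , -2≤i≤-1⇒i≡-1∨i≡-2 -2≤a a≤-1)
    where
    a≤-1 : a ≤ - + 1
    a≤-1 = i≤0∧i≢0⇒i≤-1 a≤0 a≢0
  by-profile (touched-twice _ a≤-3) = ⊥-elim (a≤-3⇒⊥ a≤-3)
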